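{- Let $\mathfrak{a}_1=(((x_1x_2)x_3)x_4)$, $\mathfrak{a}_2=((x_1(x_2x_3))x_4)$, $\mathfrak{a}_4=(x_1((x_2x_3)x_4))$, $\mathfrak{a}_5=(x_1(x_2(x_3x_4)))$ be the corresponding binary trees with $4$ leaves, and for $\{i,j\}\in\{\{1,2\},\{4,5\}\}$ let $\mathbf{Mag}^{\{i,j\}}=\mathbf{Mag}/_{\equiv}$ where $\equiv$ is the smallest operad congruence with $\mathfrak{a}_i\equiv\mathfrak{a}_j$. Then $$\mathcal{H}_{\mathbf{Mag}^{\{1,2\}}}(t)=\mathcal{H}_{\mathbf{Mag}^{\{4,5\}}}(t)=t\,\frac{1-t}{1-2t}.$$
   Context: A binary tree is either the leaf or an ordered pair of binary trees; here a product expression like $((x_1x_2)x_3)$ denotes the tree whose shape is its syntax tree (each product is an internal node, the $x_k$ are the leaves). $\mathbf{Mag}$ is the nonsymmetric set-theoretic operad of binary trees ($\mathbf{Mag}(n)$ = trees with $n$ leaves), with $\mathfrak{t}\circ_i\mathfrak{s}$ grafting the root of $\mathfrak{s}$ onto the $i$-th leaf of $\mathfrak{t}$. An operad congruence is an arity-preserving equivalence relation compatible with all partial compositions. The Hilbert series of an operad $\mathcal{O}$ with finite components is $\sum_{n\ge1}\#\mathcal{O}(n)\,t^n$. -}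

module Defs where

open import Data.Nat using (ℕ; zero; suc; _+_; _∸_; _<_; _<ᵇ_; _≥_)
open import Data.Integer using (ℤ; +_; -_; -[1+_]) renaming (_+_ to _+ℤ_; _*_ to _*ℤ_)
open import Data.Bool using (if_then_else_)
open import Data.Fin using (Fin)
open import Data.Product using (Σ; _×_; proj₁)
open import Relation.Binary.PropositionalEquality using (_≡_)

infixl 7 _∙_
data Tree : Set where
  leaf : Tree
  _∙_  : Tree → Tree → Tree

leaves : Tree → ℕ
leaves leaf      = 1
leaves (l ∙ r)   = leaves l + leaves r

Mag : ℕ → Set
Mag n = Σ Tree (λ t → leaves t ≡ n)

-- graft t i s : grafting the root of s onto the leaf of t with
-- 0-based index i (i.e. the (i+1)-th leaf; the operad's t ∘_{i+1} s).
-- Only used with i < leaves t.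
graft : Tree → ℕ → Tree → Tree
graft leaf    zero    s = s
graft leaf    (suc i) s = leaf
graft (l ∙ r) i       s =
  if i <ᵇ leaves l then graft l i s ∙ r else l ∙ graft r (i ∸ leaves l) s

data Cong (a b : Tree) : Tree → Tree → Set where
  gen    : Cong a b a b
  ≈refl  : ∀ t → Cong a b t t
  ≈sym   : ∀ {t u} → Cong a b t u → Cong a b u t
  ≈trans : ∀ {t u v} → Cong a b t u → Cong a b u v → Cong a b t v
  ≈comp  : ∀ {t t' s s'} (i : ℕ) → i < leaves t →
           Cong a b t t' → Cong a b s s' →
           Cong a b (graft t i s) (graft t' i s')

-- Mag(n)/≡ has exactly k elements: there is a surjection
-- Mag(n) → Fin k whose fibres are exactly the congruence classes
-- (equivalently, a bijection (Mag(n)/≡) ≃ Fin k).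
QuotientCard : (a b : Tree) → ℕ → ℕ → Set
QuotientCard a b n k =
  Σ (Mag n → Fin k) λ f →
    (∀ (j : Fin k) → Σ (Mag n) λ x → f x ≡ j) ×
    (∀ (x y : Mag n) →
       (Cong a b (proj₁ x) (proj₁ y) → f x ≡ f y) ×
       (f x ≡ f y → Cong a b (proj₁ x) (proj₁ y)))

Series : Set
Series = ℕ → ℤ

sumTo : ℕ → (ℕ → ℤ) → ℤ
sumTo zero    f = f 0
sumTo (suc n) f = sumTo n f +ℤ f (suc n)

_⊛_ : Series → Series → Series
(f ⊛ g) n = sumTo n (λ k → f k *ℤ g (n ∸ k))

_≋_ : Series → Series → Set
f ≋ g = ∀ n → f n ≡ g n

IsHilbertSeries : (a b : Tree) → Series → Set
IsHilbertSeries a b H =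
  (H 0 ≡ + 0) ×
  (∀ n → n ≥ 1 → Σ ℕ λ k → (H n ≡ + k) × QuotientCard a b n k)

one-2t : Series
one-2t zero             = + 1
one-2t (suc zero)       = - (+ 2)
one-2t (suc (suc _))    = + 0

t-t² : Series
t-t² zero             = + 0
t-t² (suc zero)       = + 1
t-t² (suc (suc zero)) = -[1+ 0 ]
t-t² (suc (suc (suc _))) = + 0

-- H = t(1-t)/(1-2t) in ℤ[[t]], i.e. (1 - 2t) H = t(1 - t)
-- (1 - 2t is invertible in ℤ[[t]]).
IsRationalT1-t/1-2t : Series → Set
IsRationalT1-t/1-2t H = (one-2t ⊛ H) ≋ t-t²

x : Tree
x = leaf

a₁ a₂ a₄ a₅ : Tree
a₁ = ((x ∙ x) ∙ x) ∙ x
a₂ = (x ∙ (x ∙ x)) ∙ x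
a₄ = x ∙ ((x ∙ x) ∙ x)
a₅ = x ∙ (x ∙ (x ∙ x))

-- Modulo a₁ ≡ a₂, i.e. ((AB)C)D ≡ (A(BC))D, every left factor of a product can be
-- rewritten into a left comb, so a tree is congruent to the right-branching product of
-- the left combs whose sizes are read off its right branch. These sizes form a
-- composition of n − 1 which grafting, hence the congruence, preserves; so in arity
-- n ≥ 2 the classes correspond to the 2^(n−2) compositions of n − 1, and together with
-- the single tree of arity 1 these are the coefficients of t(1 − t)/(1 − 2t).
-- Left–right mirroring maps a₁, a₂ to a₅, a₄ and commutes with grafting up to
-- renumbering the leaves, so it transports the result to the congruence a₄ ≡ a₅.
module Submission where

open import Defs
open import Data.Bool using (true; false)
open import Data.Empty using (⊥-elim)
open import Data.Fin using (Fin; zero; suc; combine; quotient; remainder)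
open import Data.Fin.Properties using (remQuot-combine; combine-remQuot)
open import Data.Integer using (ℤ; +_; -_) renaming (_+_ to _+ℤ_; _*_ to _*ℤ_)
import Data.Integer.Properties as ℤ
open import Data.List using (List; []; _∷_)
open import Data.Nat using (ℕ; zero; suc; _+_; _∸_; _^_; _≤_; _<_; _<ᵇ_; z≤n; s≤s; s≤s⁻¹)
open import Data.Nat.Properties
  using (+-assoc; +-comm; +-suc; +-identityʳ; +-cancelˡ-≡; +-cancelˡ-≤; +-mono-≤; <-irrefl;
         <⇒<ᵇ; m+n∸m≡n; m+[n∸m]≡n; m∸n≤m; m≢1+m+n; suc-injective)
open import Data.Nat.Tactic.RingSolver using (solve-∀)
open import Data.Product using (Σ; _×_; _,_; proj₁; proj₂)
open import Function using (_∘_)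
open import Level using (0ℓ)
open import Relation.Binary.Bundles using (Setoid)
open import Relation.Binary.PropositionalEquality

nodes : Tree → ℕ
nodes leaf    = 0
nodes (l ∙ r) = suc (nodes l + nodes r)

leaves≡suc-nodes : ∀ t → leaves t ≡ suc (nodes t)
leaves≡suc-nodes leaf    = refl
leaves≡suc-nodes (l ∙ r) rewrite leaves≡suc-nodes l | leaves≡suc-nodes r =
  cong suc (+-suc (nodes l) (nodes r))

<leaves⇒≤nodes : ∀ {i} t → i < leaves t → i ≤ nodes t
<leaves⇒≤nodes t i<t = s≤s⁻¹ (subst (_ <_) (leaves≡suc-nodes t) i<t)

nodes≡0⇒leaf : ∀ {t} → nodes t ≡ 0 → t ≡ leaf
nodes≡0⇒leaf {leaf} _ = refl

nodes-Mag : ∀ {n} (x : Mag (suc n)) → nodes (proj₁ x) ≡ n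
nodes-Mag (t , t∈n) = suc-injective (trans (sym (leaves≡suc-nodes t)) t∈n)

m+n<ᵇm≡false : ∀ m n → (m + n <ᵇ m) ≡ false
m+n<ᵇm≡false zero    n = refl
m+n<ᵇm≡false (suc m) n = m+n<ᵇm≡false m n

graft-left : ∀ {i} l r s → i ≤ nodes l → graft (l ∙ r) i s ≡ graft l i s ∙ r
graft-left {i} l r s i≤l rewrite leaves≡suc-nodes l
  with i <ᵇ suc (nodes l) | <⇒<ᵇ (s≤s i≤l)
... | true | _ = refl

graft-right : ∀ l r k s → graft (l ∙ r) (suc (nodes l) + k) s ≡ l ∙ graft r k s
graft-right l r k s
  rewrite leaves≡suc-nodes l | m+n<ᵇm≡false (nodes l) k | m+n∸m≡n (nodes l) k = refl

data Position (n : ℕ) : ℕ → Set where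
  within : ∀ {i} → i ≤ n → Position n i
  beyond : ∀ k → Position n (suc n + k)

position : ∀ n i → Position n i
position n       zero    = within z≤n
position zero    (suc i) = beyond i
position (suc n) (suc i) with position n i
... | within i≤n = within (s≤s i≤n)
... | beyond k   = beyond k

nodes-graft : ∀ {i} t s → i ≤ nodes t → nodes (graft t i s) ≡ nodes t + nodes s
nodes-graft leaf s z≤n = refl
nodes-graft {i} (l ∙ r) s i≤t with position (nodes l) i
... | within i≤l rewrite graft-left l r s i≤l | nodes-graft l s i≤l =
  rearrange (nodes l) (nodes s) (nodes r)
  where
  rearrange : ∀ a b c → suc (a + b + c) ≡ suc (a + c) + b
  rearrange = solve-∀
... | beyond k rewrite graft-right l r k s
                     | nodes-graft r s (+-cancelˡ-≤ (nodes l) _ _ (s≤s⁻¹ i≤t)) =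
  cong suc (sym (+-assoc (nodes l) (nodes r) (nodes s)))

mirror : Tree → Tree
mirror leaf    = leaf
mirror (l ∙ r) = mirror r ∙ mirror l

mirror-involutive : ∀ t → mirror (mirror t) ≡ t
mirror-involutive leaf    = refl
mirror-involutive (l ∙ r) = cong₂ _∙_ (mirror-involutive l) (mirror-involutive r)

nodes-mirror : ∀ t → nodes (mirror t) ≡ nodes t
nodes-mirror leaf    = refl
nodes-mirror (l ∙ r) rewrite nodes-mirror l | nodes-mirror r =
  cong suc (+-comm (nodes r) (nodes l))

leaves-mirror : ∀ t → leaves (mirror t) ≡ leaves t
leaves-mirror t rewrite leaves≡suc-nodes (mirror t) | nodes-mirror t = sym (leaves≡suc-nodes t)

i+[1+b+k]≡1+a+b⇒i+k≡a : ∀ i k a b → i + (suc b + k) ≡ suc (a + b) → i + k ≡ a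
i+[1+b+k]≡1+a+b⇒i+k≡a i k a b eq = +-cancelˡ-≡ (suc b) _ _ (begin
  suc b + (i + k)  ≡⟨ shuffle i k b ⟩
  i + (suc b + k)  ≡⟨ eq ⟩
  suc (a + b)      ≡⟨ cong suc (+-comm a b) ⟩
  suc b + a        ∎)
  where
  open ≡-Reasoning
  shuffle : ∀ i k b → suc b + (i + k) ≡ i + (suc b + k)
  shuffle = solve-∀

1+a+k+j≡1+a+b⇒k+j≡b : ∀ a k j b → suc a + k + j ≡ suc (a + b) → k + j ≡ b
1+a+k+j≡1+a+b⇒k+j≡b a k j b eq = +-cancelˡ-≡ (suc a) _ _ (trans (sym (+-assoc (suc a) k j)) eq)

1+a+k+[1+b+l]≢1+a+b : ∀ a b k l → suc a + k + (suc b + l) ≢ suc (a + b)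
1+a+k+[1+b+l]≢1+a+b a b k l eq = m≢1+m+n (a + b) (suc-injective (trans (sym eq) (shuffle a b k l)))
  where
  shuffle : ∀ a b k l → suc a + k + (suc b + l) ≡ suc (suc (a + b + (k + l)))
  shuffle = solve-∀

-- i + j ≡ nodes t says that leaf i from the left is leaf j from the right.
mirror-graft : ∀ {i j} t s → i + j ≡ nodes t →
               mirror (graft t i s) ≡ graft (mirror t) j (mirror s)
mirror-graft {zero}  {zero}  leaf s refl = refl
mirror-graft {zero}  {suc j} leaf s ()
mirror-graft {suc i} {j}     leaf s ()
mirror-graft {i} {j} (l ∙ r) s i+j≡t
  with position (nodes l) i | position (nodes (mirror r)) j
... | within i≤l | within j≤r =
  ⊥-elim (<-irrefl i+j≡t (s≤s (subst (λ n → i + j ≤ nodes l + n) (nodes-mirror r)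
                                     (+-mono-≤ i≤l j≤r))))
... | within i≤l | beyond k
  rewrite graft-left l r s i≤l | graft-right (mirror r) (mirror l) k (mirror s) =
  cong (mirror r ∙_) (mirror-graft l s (i+[1+b+k]≡1+a+b⇒i+k≡a i k (nodes l) (nodes (mirror r))
    (trans i+j≡t (cong (λ n → suc (nodes l + n)) (sym (nodes-mirror r))))))
... | beyond k   | within j≤r
  rewrite graft-right l r k s | graft-left (mirror r) (mirror l) (mirror s) j≤r =
  cong (_∙ mirror l) (mirror-graft r s (1+a+k+j≡1+a+b⇒k+j≡b (nodes l) k j (nodes r) i+j≡t))
... | beyond k   | beyond k′ =
  ⊥-elim (1+a+k+[1+b+l]≢1+a+b (nodes l) (nodes (mirror r)) k k′
    (trans i+j≡t (cong (λ n → suc (nodes l + n)) (sym (nodes-mirror r)))))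

module _ {a b : Tree} where

  Cong-setoid : Setoid 0ℓ 0ℓ
  Cong-setoid = record
    { Carrier       = Tree
    ; _≈_           = Cong a b
    ; isEquivalence = record { refl = ≈refl _ ; sym = ≈sym ; trans = ≈trans }
    }

  ≡⇒Cong : ∀ {t u} → t ≡ u → Cong a b t u
  ≡⇒Cong refl = ≈refl _

  ∙-congʳ : ∀ {t u} v → Cong a b t u → Cong a b (t ∙ v) (u ∙ v)
  ∙-congʳ v t≈u = ≈comp {t = leaf ∙ v} 0 (s≤s z≤n) (≈refl _) t≈u

  ∙-congˡ : ∀ {t u} v → Cong a b t u → Cong a b (v ∙ t) (v ∙ u)
  ∙-congˡ v t≈u =
    ≈comp 0 (s≤s z≤n) (≈comp {t = leaf ∙ leaf} 1 (s≤s (s≤s z≤n)) (≈refl _) t≈u) (≈refl v)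

  Cong-swap : ∀ {t u} → Cong a b t u → Cong b a t u
  Cong-swap gen               = ≈sym gen
  Cong-swap (≈refl t)         = ≈refl t
  Cong-swap (≈sym p)          = ≈sym (Cong-swap p)
  Cong-swap (≈trans p q)      = ≈trans (Cong-swap p) (Cong-swap q)
  Cong-swap (≈comp i i<t p q) = ≈comp i i<t (Cong-swap p) (Cong-swap q)

  module _ (a≡b : nodes a ≡ nodes b) where

    Cong-nodes : ∀ {t u} → Cong a b t u → nodes t ≡ nodes u
    Cong-nodes gen          = a≡b
    Cong-nodes (≈refl t)    = refl
    Cong-nodes (≈sym p)     = sym (Cong-nodes p)
    Cong-nodes (≈trans p q) = trans (Cong-nodes p) (Cong-nodes q)
    Cong-nodes (≈comp {t} {t′} {s} {s′} i i<t p q) = begin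
      nodes (graft t i s)    ≡⟨ nodes-graft t s i≤t ⟩
      nodes t + nodes s      ≡⟨ cong₂ _+_ (Cong-nodes p) (Cong-nodes q) ⟩
      nodes t′ + nodes s′    ≡⟨ nodes-graft t′ s′ (subst (i ≤_) (Cong-nodes p) i≤t) ⟨
      nodes (graft t′ i s′)  ∎
      where
      open ≡-Reasoning
      i≤t : i ≤ nodes t
      i≤t = <leaves⇒≤nodes t i<t

    Cong-mirror : ∀ {t u} → Cong a b t u → Cong (mirror a) (mirror b) (mirror t) (mirror u)
    Cong-mirror gen          = gen
    Cong-mirror (≈refl t)    = ≈refl (mirror t)
    Cong-mirror (≈sym p)     = ≈sym (Cong-mirror p)
    Cong-mirror (≈trans p q) = ≈trans (Cong-mirror p) (Cong-mirror q)
    Cong-mirror (≈comp {t} {t′} {s} {s′} i i<t p q) =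
      subst₂ (Cong _ _) (sym (mirror-graft t s i+j≡t)) (sym (mirror-graft t′ s′ i+j≡t′))
        (≈comp (nodes t ∸ i) j<t (Cong-mirror p) (Cong-mirror q))
      where
      i+j≡t : i + (nodes t ∸ i) ≡ nodes t
      i+j≡t = m+[n∸m]≡n (<leaves⇒≤nodes t i<t)
      i+j≡t′ : i + (nodes t ∸ i) ≡ nodes t′
      i+j≡t′ = trans i+j≡t (Cong-nodes p)
      j<t : nodes t ∸ i < leaves (mirror t)
      j<t = subst (nodes t ∸ i <_) (sym (trans (leaves-mirror t) (leaves≡suc-nodes t)))
                  (s≤s (m∸n≤m (nodes t) i))

module _ {a b c d : Tree} (φ : Tree → Tree)
         (leaves-φ : ∀ t → leaves (φ t) ≡ leaves t) (φ-involutive : ∀ t → φ (φ t) ≡ t)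
         (to : ∀ {t u} → Cong a b t u → Cong c d (φ t) (φ u))
         (from : ∀ {t u} → Cong c d t u → Cong a b (φ t) (φ u)) where

  φ-Mag : ∀ {n} → Mag n → Mag n
  φ-Mag (t , t∈n) = φ t , trans (leaves-φ t) t∈n

  QuotientCard-transport : ∀ {n k} → QuotientCard a b n k → QuotientCard c d n k
  QuotientCard-transport {n} {k} (f , f-onto , f-classifies) =
    (λ x → f (φ-Mag x)) , onto , λ x y → respects x y , reflects x y
    where
    onto : ∀ j → Σ (Mag n) λ x → f (φ-Mag x) ≡ j
    onto j with f-onto j
    ... | (t , t∈n) , fx≡j = φ-Mag (t , t∈n) ,
      trans (proj₁ (f-classifies _ _) (≡⇒Cong (φ-involutive t))) fx≡j
    respects : ∀ x y → Cong c d (proj₁ x) (proj₁ y) → f (φ-Mag x) ≡ f (φ-Mag y)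
    respects (t , _) (u , _) t≈u = proj₁ (f-classifies _ _) (from t≈u)
    reflects : ∀ x y → f (φ-Mag x) ≡ f (φ-Mag y) → Cong c d (proj₁ x) (proj₁ y)
    reflects (t , _) (u , _) fx≡fy =
      subst₂ (Cong c d) (φ-involutive t) (φ-involutive u) (to (proj₂ (f-classifies _ _) fx≡fy))

  IsHilbertSeries-transport : ∀ {H} → IsHilbertSeries a b H → IsHilbertSeries c d H
  IsHilbertSeries-transport (H₀≡0 , classes) = H₀≡0 , λ n n≥1 →
    let k , Hₙ≡k , card = classes n n≥1 in k , Hₙ≡k , QuotientCard-transport card

-- spine t lists the node counts of the left subtrees along the right branch of t;
-- an entry h stands for the part h + 1 of a composition of nodes t.
weight : List ℕ → ℕ
weight []       = 0
weight (h ∷ hs) = suc h + weight hs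

spine : Tree → List ℕ
spine leaf    = []
spine (l ∙ r) = nodes l ∷ spine r

weight-spine : ∀ t → weight (spine t) ≡ nodes t
weight-spine leaf    = refl
weight-spine (l ∙ r) = cong (λ n → suc (nodes l + n)) (weight-spine r)

graftSpine : List ℕ → ℕ → ℕ → List ℕ → List ℕ
graftSpine []       zero    p r = r
graftSpine []       (suc i) p r = []
graftSpine (h ∷ hs) i       p r with position h i
... | within _ = (h + p) ∷ hs
... | beyond k = h ∷ graftSpine hs k p r

spine-graft : ∀ t i s → spine (graft t i s) ≡ graftSpine (spine t) i (nodes s) (spine s)
spine-graft leaf    zero    s = refl
spine-graft leaf    (suc i) s = refl
spine-graft (l ∙ r) i       s with position (nodes l) i
... | within i≤l rewrite graft-left l r s i≤l | nodes-graft l s i≤l = refl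
... | beyond k   rewrite graft-right l r k s = cong (nodes l ∷_) (spine-graft r k s)

Cong⇒spine≡ : ∀ {t u} → Cong a₁ a₂ t u → spine t ≡ spine u
Cong⇒spine≡ gen          = refl
Cong⇒spine≡ (≈refl t)    = refl
Cong⇒spine≡ (≈sym p)     = sym (Cong⇒spine≡ p)
Cong⇒spine≡ (≈trans p q) = trans (Cong⇒spine≡ p) (Cong⇒spine≡ q)
Cong⇒spine≡ (≈comp {t} {t′} {s} {s′} i _ p q) = begin
  spine (graft t i s)                            ≡⟨ spine-graft t i s ⟩
  graftSpine (spine t) i (nodes s) (spine s)     ≡⟨ cong₂ (λ ps n → graftSpine ps i n (spine s))
                                                      (Cong⇒spine≡ p) (Cong-nodes refl q) ⟩
  graftSpine (spine t′) i (nodes s′) (spine s)   ≡⟨ cong (graftSpine (spine t′) i (nodes s′))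
                                                      (Cong⇒spine≡ q) ⟩
  graftSpine (spine t′) i (nodes s′) (spine s′)  ≡⟨ spine-graft t′ i s′ ⟨
  spine (graft t′ i s′)                          ∎
  where open ≡-Reasoning

leftComb : ℕ → Tree
leftComb zero    = leaf
leftComb (suc n) = leftComb n ∙ leaf

nodes-leftComb : ∀ n → nodes (leftComb n) ≡ n
nodes-leftComb zero    = refl
nodes-leftComb (suc n) = cong suc (trans (+-identityʳ _) (nodes-leftComb n))

normalForm : List ℕ → Tree
normalForm []       = leaf
normalForm (h ∷ hs) = leftComb h ∙ normalForm hs

spine-normalForm : ∀ ps → spine (normalForm ps) ≡ ps
spine-normalForm []       = refl
spine-normalForm (h ∷ hs) = cong₂ _∷_ (nodes-leftComb h) (spine-normalForm hs)

reassociate : ∀ A B C D → Cong a₁ a₂ (((A ∙ B) ∙ C) ∙ D) ((A ∙ (B ∙ C)) ∙ D)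
reassociate A B C D =
  ≈comp 0 (s≤s z≤n) (≈comp 1 (s≤s (s≤s z≤n)) (≈comp 2 (s≤s (s≤s (s≤s z≤n)))
    (≈comp 3 (s≤s (s≤s (s≤s (s≤s z≤n)))) gen (≈refl D)) (≈refl C)) (≈refl B)) (≈refl A)

absorb : ∀ B k D → Cong a₁ a₂ ((leftComb k ∙ B) ∙ D) (leftComb (k + leaves B) ∙ D)
absorb leaf      k D = ≡⇒Cong (cong (λ n → leftComb n ∙ D) (+-comm 1 k))
absorb (B₁ ∙ B₂) k D = begin
  (leftComb k ∙ (B₁ ∙ B₂)) ∙ D                ≈⟨ reassociate (leftComb k) B₁ B₂ D ⟨
  ((leftComb k ∙ B₁) ∙ B₂) ∙ D                ≈⟨ ∙-congʳ D (absorb B₁ k B₂) ⟩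
  (leftComb (k + leaves B₁) ∙ B₂) ∙ D         ≈⟨ absorb B₂ (k + leaves B₁) D ⟩
  leftComb (k + leaves B₁ + leaves B₂) ∙ D    ≡⟨ cong (λ n → leftComb n ∙ D)
                                                   (+-assoc k (leaves B₁) (leaves B₂)) ⟩
  leftComb (k + (leaves B₁ + leaves B₂)) ∙ D  ∎
  where open import Relation.Binary.Reasoning.Setoid Cong-setoid

flatten-left : ∀ l D → Cong a₁ a₂ (l ∙ D) (leftComb (nodes l) ∙ D)
flatten-left leaf    D = ≈refl _
flatten-left (A ∙ B) D = begin
  (A ∙ B) ∙ D                        ≈⟨ ∙-congʳ D (flatten-left A B) ⟩
  (leftComb (nodes A) ∙ B) ∙ D       ≈⟨ absorb B (nodes A) D ⟩
  leftComb (nodes A + leaves B) ∙ D  ≡⟨ cong (λ n → leftComb n ∙ D)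
                                         (trans (cong (λ n → nodes A + n) (leaves≡suc-nodes B))
                                                (+-suc (nodes A) (nodes B))) ⟩
  leftComb (nodes (A ∙ B)) ∙ D       ∎
  where open import Relation.Binary.Reasoning.Setoid Cong-setoid

Cong-normalForm : ∀ t → Cong a₁ a₂ t (normalForm (spine t))
Cong-normalForm leaf    = ≈refl leaf
Cong-normalForm (l ∙ r) =
  ≈trans (flatten-left l r) (∙-congˡ (leftComb (nodes l)) (Cong-normalForm r))

spine≡⇒Cong : ∀ {t u} → spine t ≡ spine u → Cong a₁ a₂ t u
spine≡⇒Cong {t} {u} t≡u =
  ≈trans (Cong-normalForm t) (≈trans (≡⇒Cong (cong normalForm t≡u)) (≈sym (Cong-normalForm u)))

-- A composition of m + 1 is read one unit at a time: each of the m units after the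
-- first either starts a new part (bit 0) or enlarges the current one (bit 1).
-- The value of encode on [] is arbitrary: compositions are never empty.
push : Fin 2 → List ℕ → List ℕ
push zero       ps       = 0 ∷ ps
push (suc zero) []       = []
push (suc zero) (h ∷ hs) = suc h ∷ hs

encode : List ℕ → (m : ℕ) → Fin (2 ^ m)
encode _            zero    = zero
encode []           (suc m) = combine {2} {2 ^ m} zero (encode [] m)
encode (zero ∷ hs)  (suc m) = combine {2} {2 ^ m} zero (encode hs m)
encode (suc h ∷ hs) (suc m) = combine {2} {2 ^ m} (suc zero) (encode (h ∷ hs) m)

decode : (m : ℕ) → Fin (2 ^ m) → List ℕ
decode zero    _ = 0 ∷ []
decode (suc m) j = push (quotient (2 ^ m) j) (decode m (remainder {2} (2 ^ m) j))

weight-push : ∀ b ps {m} → weight ps ≡ suc m → weight (push b ps) ≡ suc (suc m)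
weight-push zero       ps       eq = cong suc eq
weight-push (suc zero) (h ∷ hs) eq = cong suc eq

weight-decode : ∀ m j → weight (decode m j) ≡ suc m
weight-decode zero    j = refl
weight-decode (suc m) j =
  weight-push (quotient (2 ^ m) j) _ (weight-decode m (remainder {2} (2 ^ m) j))

encode-push : ∀ b ps {m} → weight ps ≡ suc m →
              encode (push b ps) (suc m) ≡ combine {2} {2 ^ m} b (encode ps m)
encode-push zero       (h ∷ hs) _ = refl
encode-push (suc zero) (h ∷ hs) _ = refl

encode-decode : ∀ m j → encode (decode m j) m ≡ j
encode-decode zero    zero = refl
encode-decode (suc m) j    = begin
  encode (push b (decode m c)) (suc m)           ≡⟨ encode-push b (decode m c) (weight-decode m c) ⟩
  combine {2} {2 ^ m} b (encode (decode m c) m)  ≡⟨ cong (combine b) (encode-decode m c) ⟩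
  combine {2} {2 ^ m} b c                        ≡⟨ combine-remQuot {2} (2 ^ m) j ⟩
  j                                              ∎
  where
  open ≡-Reasoning
  b : Fin 2
  b = quotient (2 ^ m) j
  c : Fin (2 ^ m)
  c = remainder {2} (2 ^ m) j

decode-combine : ∀ m b c → decode (suc m) (combine {2} {2 ^ m} b c) ≡ push b (decode m c)
decode-combine m b c =
  cong (λ bc → push (proj₁ bc) (decode m (proj₂ bc))) (remQuot-combine {2} {2 ^ m} b c)

decode-encode : ∀ ps m → weight ps ≡ suc m → decode m (encode ps m) ≡ ps
decode-encode (zero ∷ [])     zero    _  = refl
decode-encode (zero ∷ h ∷ hs) (suc m) eq =
  trans (decode-combine m zero _) (cong (0 ∷_) (decode-encode (h ∷ hs) m (suc-injective eq)))
decode-encode (suc h ∷ hs)    (suc m) eq =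
  trans (decode-combine m (suc zero) _)
        (cong (push (suc zero)) (decode-encode (h ∷ hs) m (suc-injective eq)))

quotientCard-1 : QuotientCard a₁ a₂ 1 1
quotientCard-1 = (λ _ → zero) , (λ { zero → (leaf , refl) , refl }) , λ x y →
  (λ _ → refl) ,
  λ _ → subst₂ (Cong a₁ a₂) (sym (nodes≡0⇒leaf (nodes-Mag x))) (sym (nodes≡0⇒leaf (nodes-Mag y)))
                (≈refl leaf)

quotientCard-2+ : ∀ m → QuotientCard a₁ a₂ (suc (suc m)) (2 ^ m)
quotientCard-2+ m = class , onto , λ x y → respects x y , reflects x y
  where
  open ≡-Reasoning
  class : Mag (suc (suc m)) → Fin (2 ^ m)
  class (t , _) = encode (spine t) m
  weight-class : ∀ x → weight (spine (proj₁ x)) ≡ suc m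
  weight-class x = trans (weight-spine (proj₁ x)) (nodes-Mag x)
  leaves-normalForm : ∀ j → leaves (normalForm (decode m j)) ≡ suc (suc m)
  leaves-normalForm j = begin
    leaves (normalForm ps)                ≡⟨ leaves≡suc-nodes (normalForm ps) ⟩
    suc (nodes (normalForm ps))           ≡⟨ cong suc (weight-spine (normalForm ps)) ⟨
    suc (weight (spine (normalForm ps)))  ≡⟨ cong (suc ∘ weight) (spine-normalForm ps) ⟩
    suc (weight ps)                       ≡⟨ cong suc (weight-decode m j) ⟩
    suc (suc m)                           ∎
    where
    ps : List ℕ
    ps = decode m j
  onto : ∀ j → Σ (Mag (suc (suc m))) λ x → class x ≡ j
  onto j = (normalForm (decode m j) , leaves-normalForm j) ,
           trans (cong (λ ps → encode ps m) (spine-normalForm (decode m j))) (encode-decode m j)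
  respects : ∀ x y → Cong a₁ a₂ (proj₁ x) (proj₁ y) → class x ≡ class y
  respects (t , _) (u , _) t≈u = cong (λ ps → encode ps m) (Cong⇒spine≡ t≈u)
  reflects : ∀ x y → class x ≡ class y → Cong a₁ a₂ (proj₁ x) (proj₁ y)
  reflects x@(t , _) y@(u , _) eq = spine≡⇒Cong (begin
    spine t                        ≡⟨ decode-encode (spine t) m (weight-class x) ⟨
    decode m (encode (spine t) m)  ≡⟨ cong (decode m) eq ⟩
    decode m (encode (spine u) m)  ≡⟨ decode-encode (spine u) m (weight-class y) ⟩
    spine u                        ∎)

hilbertSeries : Series
hilbertSeries zero          = + 0
hilbertSeries (suc zero)    = + 1
hilbertSeries (suc (suc m)) = + (2 ^ m)

isHilbertSeries-a₁a₂ : IsHilbertSeries a₁ a₂ hilbertSeries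
isHilbertSeries-a₁a₂ = refl , λ where
  (suc zero)    _ → 1 , refl , quotientCard-1
  (suc (suc m)) _ → 2 ^ m , refl , quotientCard-2+ m

sumTo-one-2t : ∀ n (F : ℕ → ℤ) →
               sumTo (suc n) (λ k → one-2t k *ℤ F k) ≡ (one-2t 0 *ℤ F 0) +ℤ (one-2t 1 *ℤ F 1)
sumTo-one-2t zero    F = refl
sumTo-one-2t (suc n) F = trans (ℤ.+-identityʳ _) (sumTo-one-2t n F)

hilbertSeries-rational : IsRationalT1-t/1-2t hilbertSeries
hilbertSeries-rational zero                = refl
hilbertSeries-rational (suc zero)          = refl
hilbertSeries-rational (suc (suc zero))    = refl
hilbertSeries-rational (suc (suc (suc m))) = begin
  (one-2t ⊛ hilbertSeries) (suc (suc (suc m)))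
    ≡⟨ sumTo-one-2t (suc (suc m)) (λ k → hilbertSeries (suc (suc (suc m)) ∸ k)) ⟩
  + 1 *ℤ + (2 ^ suc m) +ℤ - + 2 *ℤ + (2 ^ m)
    ≡⟨ cong₂ _+ℤ_ (ℤ.*-identityˡ (+ (2 ^ suc m))) (sym (ℤ.neg-distribˡ-* (+ 2) (+ (2 ^ m)))) ⟩
  + (2 ^ suc m) +ℤ - (+ 2 *ℤ + (2 ^ m))
    ≡⟨ cong (λ z → + (2 ^ suc m) +ℤ - z) (ℤ.pos-* 2 (2 ^ m)) ⟨
  + (2 ^ suc m) +ℤ - + (2 ^ suc m)
    ≡⟨ ℤ.+-inverseʳ (+ (2 ^ suc m)) ⟩
  + 0
    ∎
  where open ≡-Reasoning

theorem4p2p1 : (Σ Series λ H → IsHilbertSeries a₁ a₂ H × IsRationalT1-t/1-2t H)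
               × (Σ Series λ H → IsHilbertSeries a₄ a₅ H × IsRationalT1-t/1-2t H)
theorem4p2p1 =
  (hilbertSeries , isHilbertSeries-a₁a₂ , hilbertSeries-rational) ,
  (hilbertSeries , isHilbertSeries-a₄a₅ , hilbertSeries-rational)
  where
  -- mirror a₁ = a₅ and mirror a₂ = a₄ hold by computation.
  mirrored : ∀ {a b t u} → nodes a ≡ nodes b → Cong a b t u →
             Cong (mirror b) (mirror a) (mirror t) (mirror u)
  mirrored a≡b t≈u = Cong-swap (Cong-mirror a≡b t≈u)
  isHilbertSeries-a₄a₅ : IsHilbertSeries a₄ a₅ hilbertSeries
  isHilbertSeries-a₄a₅ = IsHilbertSeries-transport mirror leaves-mirror mirror-involutive
                           (mirrored refl) (mirrored refl) isHilbertSeries-a₁a₂
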